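{- Let $n\ge 1$, $a$, $k\ge 1$, $d\ge 1$ be integers, and let $K_{n,n}$ be the complete bipartite graph with both parts of size $n$. Suppose the equation $ax+(a+1)y=n$ has two solutions $(x_1,y_1)$ and $(x_2,y_2)$ in nonnegative integers (not necessarily different), and put $z_1=x_1+y_1$, $z_2=x_2+y_2$. Then $K_{n,n}$ has an equitable $(z_1+z_2,k,d)$-tree-coloring in which every color class has size either $a$ or $a+1$.
   Context: A $t$-coloring of a graph $G$ is a map $f:V(G)\to\{1,\dots,t\}$ (not necessarily surjective) with color classes $V_i=f^{ -1}(i)$; it is equitable if $||V_i|-|V_j||\le 1$ for all $i,j$. It is a $(t,k,d)$-tree-coloring if for every $i$, each connected component of $G[V_i]$ is a tree of maximum degree at most $k$ and diameter at most $d$. -}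

module Defs where

open import Data.Nat using (ℕ; zero; suc; _≤_)
open import Data.Fin using (Fin; _≟_)
open import Data.Product using (_×_; _,_; ∃; Σ; ∃-syntax)
open import Data.List using (List; []; _∷_; _++_; [_]; length; filter; cartesianProduct; allFin)
open import Data.List.Relation.Unary.All using (All)
open import Data.List.Relation.Unary.Unique.Propositional using (Unique)
open import Data.Unit using (⊤)
open import Data.Empty using (⊥)
open import Relation.Nullary using (¬_)
open import Relation.Binary.PropositionalEquality using (_≡_; _≢_)

-- Generic notions for a graph with vertex type V and adjacency Adj,
-- restricted to the induced subgraph on the vertex set P.

module _ {V : Set} (Adj : V → V → Set) (P : V → Set) where

  data Walk : V → V → ℕ → Set where
    nil  : ∀ {u} → P u → Walk u u 0
    cons : ∀ {u v w l} → P u → Adj u v → Walk v w l → Walk u w (suc l)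

  Connected : V → V → Set
  Connected u w = ∃[ l ] Walk u w l

  Chain : List V → Set
  Chain []           = ⊤
  Chain (x ∷ [])     = ⊤
  Chain (x ∷ y ∷ xs) = Adj x y × Chain (y ∷ xs)

  IsCycle : V → List V → Set
  IsCycle u cs = (2 ≤ length cs) × Unique (u ∷ cs) × All P (u ∷ cs) × Chain (u ∷ cs ++ [ u ])

  Acyclic : Set
  Acyclic = ∀ u cs → ¬ IsCycle u cs

  MaxDegreeAtMost : ℕ → Set
  MaxDegreeAtMost k = ∀ v → P v → (ns : List V) → Unique ns →
                      All (λ u → P u × Adj v u) ns → length ns ≤ k

  DiameterAtMost : ℕ → Set
  DiameterAtMost d = ∀ u w → Connected u w → ∃[ l ] (l ≤ d × Walk u w l)

  TreeComponents : ℕ → ℕ → Set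
  TreeComponents k d = Acyclic × MaxDegreeAtMost k × DiameterAtMost d

-- The complete bipartite graph K_{n,n}: vertices (side, index)

KVertex : ℕ → Set
KVertex n = Fin 2 × Fin n

KAdj : ∀ {n} → KVertex n → KVertex n → Set
KAdj (p , _) (q , _) = p ≢ q

KVertices : (n : ℕ) → List (KVertex n)
KVertices n = cartesianProduct (allFin 2) (allFin n)

Coloring : ℕ → ℕ → Set
Coloring n t = KVertex n → Fin t

ColorClass : ∀ {n t} → Coloring n t → Fin t → KVertex n → Set
ColorClass f i v = f v ≡ i

classSize : ∀ {n t} → Coloring n t → Fin t → ℕ
classSize {n} f i = length (filter (λ v → f v ≟ i) (KVertices n))

Equitable : ∀ {n t} → Coloring n t → Set
Equitable f = ∀ i j → classSize f i ≤ suc (classSize f j)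

IsTreeColoring : ∀ {n t} → Coloring n t → ℕ → ℕ → Set
IsTreeColoring f k d = ∀ i → TreeComponents KAdj (ColorClass f i) k d

-- Colour the two sides of K_{n,n} independently: split each side into consecutive
-- blocks, x of size a and y of size a + 1, using z₁ colours on one side and z₂ fresh
-- colours on the other.  Every colour class then lies inside one side, so it is an
-- independent set and its components are single vertices.  The sizes a and a + 1 make the colouring equitable, and a
-- must be nonnegative because n ≥ 1.
module Submission where

open import Defs
open import Data.Nat using (ℕ; _≤_; _+_)
open import Data.Integer using (ℤ; +_) renaming (_+_ to _+ℤ_; _*_ to _*ℤ_)
open import Data.Fin using (Fin)
open import Data.Product using (_×_; ∃-syntax)
open import Data.Sum using (_⊎_)
open import Relation.Binary.PropositionalEquality using (_≡_)

open import Data.Nat using (suc; zero; _*_; z≤n; s≤s)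
open import Data.Nat.Properties using (≤-refl; ≤-reflexive; ≤-trans; n≤1+n; m≤m+n; +-comm; *-comm; +-identityʳ)
open import Data.Integer as ℤ using (-[1+_]; 0ℤ; NonPositive)
import Data.Integer.Properties as ℤ
open import Data.Fin using (zero; suc; _↑ˡ_; _↑ʳ_; splitAt; join; _≟_)
open import Data.Fin.Properties using (splitAt-↑ˡ; splitAt-↑ʳ; join-splitAt; suc-injective; ↑ˡ-injective; ↑ʳ-injective)
open import Data.Product using (_,_; proj₁)
open import Data.Sum using (inj₁; inj₂; [_,_])
import Data.Sum
open import Data.List using (List; []; _∷_; _++_; map; filter; length; replicate; tabulate; lookup; allFin)
open import Data.List.Properties using (filter-++; length-++; length-map; length-replicate; map-++; map-∘; map-tabulate; tabulate-lookup; ++-identityʳ)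
open import Data.List.Relation.Unary.All using (_∷_)
open import Data.Vec as Vec using (Vec; sum)
import Data.Vec.Properties as Vec
open import Function using (_∘_; id; Injective)
open import Relation.Nullary using (¬_; yes; no)
open import Relation.Unary using (Decidable)
open import Relation.Binary.PropositionalEquality using (refl; sym; trans; cong; cong₂; subst; _≢_; module ≡-Reasoning)

module _ {V : Set} {Adj : V → V → Set} {P : V → Set}
         (independent : ∀ {u v} → P u → P v → ¬ Adj u v) where

  walk-source : ∀ {u w l} → Walk Adj P u w l → P u
  walk-source (nil pu)      = pu
  walk-source (cons pu _ _) = pu

  independent⇒acyclic : Acyclic Adj P
  independent⇒acyclic u (c ∷ _) (_ , _ , pu ∷ pc ∷ _ , u~c , _) = independent pu pc u~c

  independent⇒maxDegree : ∀ k → MaxDegreeAtMost Adj P k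
  independent⇒maxDegree k v pv []                    _ _              = z≤n
  independent⇒maxDegree k v pv (u ∷ _) _ ((pu , v~u) ∷ _) with () ← independent pv pu v~u

  independent⇒diameter : ∀ d → DiameterAtMost Adj P d
  independent⇒diameter d u u (_ , nil pu)           = 0 , z≤n , nil pu
  independent⇒diameter d u w (_ , cons pu u~v walk) with () ← independent pu (walk-source walk) u~v

  independent⇒treeComponents : ∀ k d → TreeComponents Adj P k d
  independent⇒treeComponents k d =
    independent⇒acyclic , independent⇒maxDegree k , independent⇒diameter d

length-filter-map : ∀ {A B : Set} {Q : B → Set} (Q? : Decidable Q) (g : A → B) xs →
  length (filter Q? (map g xs)) ≡ length (filter (Q? ∘ g) xs)
length-filter-map Q? g []       = refl
length-filter-map Q? g (x ∷ xs) with Q? (g x)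
... | yes _ = cong suc (length-filter-map Q? g xs)
... | no  _ = length-filter-map Q? g xs

occurrences : ∀ {t} → Fin t → List (Fin t) → ℕ
occurrences i = length ∘ filter (_≟ i)

module _ {t : ℕ} where

  occurrences-++ : ∀ (i : Fin t) xs ys →
    occurrences i (xs ++ ys) ≡ occurrences i xs + occurrences i ys
  occurrences-++ i xs ys = trans (cong length (filter-++ (_≟ i) xs ys)) (length-++ (filter (_≟ i) xs))

  occurrences-replicate-≡ : ∀ (i : Fin t) s → occurrences i (replicate s i) ≡ s
  occurrences-replicate-≡ i zero    = refl
  occurrences-replicate-≡ i (suc s) with i ≟ i
  ... | yes _ = cong suc (occurrences-replicate-≡ i s)
  ... | no i≢i with () ← i≢i refl

  occurrences-replicate-≢ : ∀ {i j : Fin t} → j ≢ i → ∀ s → occurrences i (replicate s j) ≡ 0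
  occurrences-replicate-≢ j≢i zero    = refl
  occurrences-replicate-≢ {i} {j} j≢i (suc s) with j ≟ i
  ... | yes j≡i with () ← j≢i j≡i
  ... | no  _   = occurrences-replicate-≢ j≢i s

module _ {t u : ℕ} (g : Fin t → Fin u) where

  occurrences-map-injective : Injective _≡_ _≡_ g → ∀ i xs → occurrences (g i) (map g xs) ≡ occurrences i xs
  occurrences-map-injective g-inj i xs =
    trans (length-filter-map (_≟ g i) g xs) (cong length (filter-cong xs))
    where
    filter-cong : ∀ xs → filter ((_≟ g i) ∘ g) xs ≡ filter (_≟ i) xs
    filter-cong []       = refl
    filter-cong (x ∷ xs) with g x ≟ g i | x ≟ i
    ... | yes _     | yes _    = cong (x ∷_) (filter-cong xs)
    ... | no  _     | no  _    = filter-cong xs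
    ... | yes gx≡gi | no  x≢i  with () ← x≢i (g-inj gx≡gi)
    ... | no  gx≢gi | yes refl with () ← gx≢gi refl

  occurrences-map-outsideImage : ∀ {i} → (∀ x → g x ≢ i) → ∀ xs → occurrences i (map g xs) ≡ 0
  occurrences-map-outsideImage gx≢i []       = refl
  occurrences-map-outsideImage {i} gx≢i (x ∷ xs) with g x ≟ i
  ... | yes gx≡i with () ← gx≢i x gx≡i
  ... | no  _    = occurrences-map-outsideImage gx≢i xs

blockColouring : ∀ {z} → Vec ℕ z → List (Fin z)
blockColouring Vec.[]         = []
blockColouring (s Vec.∷ sizes) = replicate s zero ++ map suc (blockColouring sizes)

length-blockColouring : ∀ {z} (sizes : Vec ℕ z) → length (blockColouring sizes) ≡ sum sizes
length-blockColouring Vec.[]          = refl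
length-blockColouring (s Vec.∷ sizes) = begin
  length (replicate s zero ++ map suc (blockColouring sizes))
    ≡⟨ length-++ (replicate s zero) ⟩
  length (replicate s zero) + length (map suc (blockColouring sizes))
    ≡⟨ cong₂ _+_ (length-replicate s) (length-map suc (blockColouring sizes)) ⟩
  s + length (blockColouring sizes)
    ≡⟨ cong (λ m → s + m) (length-blockColouring sizes) ⟩
  s + sum sizes
    ∎
  where open ≡-Reasoning

occurrences-blockColouring : ∀ {z} (sizes : Vec ℕ z) i →
  occurrences i (blockColouring sizes) ≡ Vec.lookup sizes i
occurrences-blockColouring (s Vec.∷ sizes) i =
  trans (occurrences-++ i (replicate s zero) (map suc (blockColouring sizes))) (byColour i)
  where
  byColour : ∀ i → occurrences i (replicate s zero) + occurrences i (map suc (blockColouring sizes))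
              ≡ Vec.lookup (s Vec.∷ sizes) i
  byColour zero    = trans (cong₂ _+_ (occurrences-replicate-≡ zero s)
                                   (occurrences-map-outsideImage suc (λ _ ()) (blockColouring sizes)))
                        (+-identityʳ s)
  byColour (suc c) = cong₂ _+_ (occurrences-replicate-≢ (λ ()) s)
                            (trans (occurrences-map-injective suc suc-injective c (blockColouring sizes))
                                   (occurrences-blockColouring sizes c))

SizeAOrA+1 : ℕ → ℕ → Set
SizeAOrA+1 a m = m ≡ a ⊎ m ≡ a + 1

blockSizes : ∀ a x y → Vec ℕ (x + y)
blockSizes a x y = Vec.replicate x a Vec.++ Vec.replicate y (a + 1)

sum-replicate : ∀ x a → sum (Vec.replicate x a) ≡ x * a
sum-replicate zero    a = refl
sum-replicate (suc x) a = cong (λ m → a + m) (sum-replicate x a)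

sum-blockSizes : ∀ a x y → sum (blockSizes a x y) ≡ a * x + (a + 1) * y
sum-blockSizes a x y = begin
  sum (Vec.replicate x a Vec.++ Vec.replicate y (a + 1))      ≡⟨ Vec.sum-++ (Vec.replicate x a) ⟩
  sum (Vec.replicate x a) + sum (Vec.replicate y (a + 1))     ≡⟨ cong₂ _+_ (sum-replicate x a) (sum-replicate y (a + 1)) ⟩
  x * a + y * (a + 1)                                         ≡⟨ cong₂ _+_ (*-comm x a) (*-comm y (a + 1)) ⟩
  a * x + (a + 1) * y                                         ∎
  where open ≡-Reasoning

lookup-blockSizes : ∀ a x y i → SizeAOrA+1 a (Vec.lookup (blockSizes a x y) i)
lookup-blockSizes a x y i
  rewrite Vec.lookup-splitAt x (Vec.replicate x a) (Vec.replicate y (a + 1)) i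
  with splitAt x i
... | inj₁ c = inj₁ (Vec.lookup-replicate c a)
... | inj₂ c = inj₂ (Vec.lookup-replicate c (a + 1))

listColouring : ∀ {n z} (cs : List (Fin z)) → length cs ≡ n → Fin n → Fin z
listColouring cs refl = lookup cs

tabulate-listColouring : ∀ {n z} (cs : List (Fin z)) (eq : length cs ≡ n) →
  tabulate (listColouring cs eq) ≡ cs
tabulate-listColouring cs refl = tabulate-lookup cs

length-blocks : ∀ a x y → length (blockColouring (blockSizes a x y)) ≡ a * x + (a + 1) * y
length-blocks a x y = trans (length-blockColouring (blockSizes a x y)) (sum-blockSizes a x y)

blockSide : ∀ {n} a x y → a * x + (a + 1) * y ≡ n → Fin n → Fin (x + y)
blockSide a x y eq = listColouring (blockColouring (blockSizes a x y)) (trans (length-blocks a x y) eq)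

tabulate-blockSide : ∀ {n} a x y (eq : a * x + (a + 1) * y ≡ n) →
  tabulate (blockSide a x y eq) ≡ blockColouring (blockSizes a x y)
tabulate-blockSide a x y eq = tabulate-listColouring (blockColouring (blockSizes a x y)) (trans (length-blocks a x y) eq)

occurrences-blockSide : ∀ {n} a x y (eq : a * x + (a + 1) * y ≡ n) c →
  SizeAOrA+1 a (occurrences c (tabulate (blockSide a x y eq)))
occurrences-blockSide a x y eq c = subst (SizeAOrA+1 a) (sym occurrences≡size) (lookup-blockSizes a x y c)
  where
  occurrences≡size : occurrences c (tabulate (blockSide a x y eq)) ≡ Vec.lookup (blockSizes a x y) c
  occurrences≡size = trans (cong (occurrences c) (tabulate-blockSide a x y eq))
                           (occurrences-blockColouring (blockSizes a x y) c)

↑ˡ≢↑ʳ : ∀ {m n} (i : Fin m) (j : Fin n) → i ↑ˡ n ≢ m ↑ʳ j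
↑ˡ≢↑ʳ {m} {n} i j eq with () ← trans (sym (splitAt-↑ˡ m i n)) (trans (cong (splitAt m) eq) (splitAt-↑ʳ m n j))

↑-elim : ∀ {m n} (Q : Fin (m + n) → Set) → (∀ i → Q (i ↑ˡ n)) → (∀ j → Q (m ↑ʳ j)) → ∀ k → Q k
↑-elim {m} {n} Q left right k = subst Q (join-splitAt m n k) ([_,_] {C = Q ∘ join m n} left right (splitAt m k))

classSize≡occurrences : ∀ {n t} (f : Coloring n t) i → classSize f i ≡ occurrences i (map f (KVertices n))
classSize≡occurrences {n} f i = sym (length-filter-map (_≟ i) f (KVertices n))

module _ {n z₁ z₂ : ℕ} (g₁ : Fin n → Fin z₁) (g₂ : Fin n → Fin z₂) where

  bipartiteColouring : Coloring n (z₁ + z₂)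
  bipartiteColouring (zero  , j) = g₁ j ↑ˡ z₂
  bipartiteColouring (suc _ , j) = z₁ ↑ʳ g₂ j

  sameColour⇒sameSide : ∀ u v → bipartiteColouring u ≡ bipartiteColouring v → proj₁ u ≡ proj₁ v
  sameColour⇒sameSide (zero     , _) (zero     , _) _ = refl
  sameColour⇒sameSide (suc zero , _) (suc zero , _) _ = refl
  sameColour⇒sameSide (zero     , _) (suc zero , _) e with () ← ↑ˡ≢↑ʳ _ _ e
  sameColour⇒sameSide (suc zero , _) (zero     , _) e with () ← ↑ˡ≢↑ʳ _ _ (sym e)

  bipartiteColouring-isTreeColouring : ∀ k d → IsTreeColoring bipartiteColouring k d
  bipartiteColouring-isTreeColouring k d i = independent⇒treeComponents independent k d
    where
    independent : ∀ {u v} → ColorClass bipartiteColouring i u → ColorClass bipartiteColouring i v → ¬ KAdj u v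
    independent {u} {v} fu≡i fv≡i = λ u≁v → u≁v (sameColour⇒sameSide u v (trans fu≡i (sym fv≡i)))

  map-bipartiteColouring :
    map bipartiteColouring (KVertices n) ≡ map (_↑ˡ z₂) (tabulate g₁) ++ map (z₁ ↑ʳ_) (tabulate g₂)
  map-bipartiteColouring = begin
    map f (map (zero ,_) (allFin n) ++ map (suc zero ,_) (allFin n) ++ [])
      ≡⟨ map-++ f (map (zero ,_) (allFin n)) _ ⟩
    map f (map (zero ,_) (allFin n)) ++ map f (map (suc zero ,_) (allFin n) ++ [])
      ≡⟨ cong₂ _++_ (tabulate-side (zero ,_))
                    (trans (cong (map f) (++-identityʳ _)) (tabulate-side (suc zero ,_))) ⟩
    tabulate (λ j → g₁ j ↑ˡ z₂) ++ tabulate (λ j → z₁ ↑ʳ g₂ j)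
      ≡⟨ cong₂ _++_ (map-tabulate g₁ (_↑ˡ z₂)) (map-tabulate g₂ (z₁ ↑ʳ_)) ⟨
    map (_↑ˡ z₂) (tabulate g₁) ++ map (z₁ ↑ʳ_) (tabulate g₂)
      ∎
    where
    open ≡-Reasoning
    f : Coloring n (z₁ + z₂)
    f = bipartiteColouring
    tabulate-side : (onSide : Fin n → KVertex n) → map f (map onSide (allFin n)) ≡ tabulate (f ∘ onSide)
    tabulate-side onSide = trans (sym (map-∘ (allFin n))) (map-tabulate id (f ∘ onSide))

  classSize-bipartiteColouring : ∀ i → classSize bipartiteColouring i
    ≡ occurrences i (map (_↑ˡ z₂) (tabulate g₁)) + occurrences i (map (z₁ ↑ʳ_) (tabulate g₂))
  classSize-bipartiteColouring i = begin
    classSize bipartiteColouring i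
      ≡⟨ classSize≡occurrences bipartiteColouring i ⟩
    occurrences i (map bipartiteColouring (KVertices n))
      ≡⟨ cong (occurrences i) map-bipartiteColouring ⟩
    occurrences i (map (_↑ˡ z₂) (tabulate g₁) ++ map (z₁ ↑ʳ_) (tabulate g₂))
      ≡⟨ occurrences-++ i (map (_↑ˡ z₂) (tabulate g₁)) _ ⟩
    occurrences i (map (_↑ˡ z₂) (tabulate g₁)) + occurrences i (map (z₁ ↑ʳ_) (tabulate g₂))
      ∎
    where open ≡-Reasoning

  classSize-↑ˡ : ∀ c → classSize bipartiteColouring (c ↑ˡ z₂) ≡ occurrences c (tabulate g₁)
  classSize-↑ˡ c = trans (classSize-bipartiteColouring (c ↑ˡ z₂)) (trans
    (cong₂ _+_ (occurrences-map-injective (_↑ˡ z₂) (↑ˡ-injective z₂ _ _) c (tabulate g₁))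
               (occurrences-map-outsideImage (z₁ ↑ʳ_) (λ j e → ↑ˡ≢↑ʳ c j (sym e)) (tabulate g₂)))
    (+-identityʳ _))

  classSize-↑ʳ : ∀ c → classSize bipartiteColouring (z₁ ↑ʳ c) ≡ occurrences c (tabulate g₂)
  classSize-↑ʳ c = trans (classSize-bipartiteColouring (z₁ ↑ʳ c))
    (cong₂ _+_ (occurrences-map-outsideImage (_↑ˡ z₂) (λ i e → ↑ˡ≢↑ʳ i c e) (tabulate g₁))
               (occurrences-map-injective (z₁ ↑ʳ_) (↑ʳ-injective z₁ _ _) c (tabulate g₂)))

  classSizes-bipartiteColouring : (Q : ℕ → Set) →
    (∀ c → Q (occurrences c (tabulate g₁))) → (∀ c → Q (occurrences c (tabulate g₂))) →
    ∀ i → Q (classSize bipartiteColouring i)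
  classSizes-bipartiteColouring Q Q₁ Q₂ = ↑-elim (Q ∘ classSize bipartiteColouring)
    (λ c → subst Q (sym (classSize-↑ˡ c)) (Q₁ c))
    (λ c → subst Q (sym (classSize-↑ʳ c)) (Q₂ c))

sizesAOrA+1⇒equitable : ∀ {n t} (f : Coloring n t) a → (∀ i → SizeAOrA+1 a (classSize f i)) → Equitable f
sizesAOrA+1⇒equitable f a sizes i j = ≤-trans (≤1+a (sizes i)) (s≤s (a≤ (sizes j)))
  where
  ≤1+a : ∀ {m} → SizeAOrA+1 a m → m ≤ suc a
  ≤1+a (inj₁ refl) = n≤1+n a
  ≤1+a (inj₂ refl) = ≤-reflexive (+-comm a 1)
  a≤ : ∀ {m} → SizeAOrA+1 a m → a ≤ m
  a≤ (inj₁ refl) = ≤-refl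
  a≤ (inj₂ refl) = m≤m+n a 1

nonPositive*natural≤0 : ∀ i .{{_ : NonPositive i}} x → i *ℤ + x ℤ.≤ 0ℤ
nonPositive*natural≤0 i x = subst (i *ℤ + x ℤ.≤_) (ℤ.*-zeroʳ i) (ℤ.*-monoˡ-≤-nonPos i (ℤ.+≤+ z≤n))

-- The split on m makes a + 1 reduce to a literal, so that its NonPositive instance is found.
negativeCoefficients≤0 : ∀ m x y → -[1+ m ] *ℤ + x +ℤ (-[1+ m ] +ℤ + 1) *ℤ + y ℤ.≤ 0ℤ
negativeCoefficients≤0 zero     x y = ℤ.+-mono-≤ (nonPositive*natural≤0 -[1+ 0 ] x) (nonPositive*natural≤0 0ℤ y)
negativeCoefficients≤0 (suc m) x y = ℤ.+-mono-≤ (nonPositive*natural≤0 -[1+ suc m ] x) (nonPositive*natural≤0 -[1+ m ] y)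

pos-equation⇒ℕ-equation : ∀ a x y n → + a *ℤ + x +ℤ (+ a +ℤ + 1) *ℤ + y ≡ + n → a * x + (a + 1) * y ≡ n
pos-equation⇒ℕ-equation a x y n eq = ℤ.+-injective (begin
  + (a * x + (a + 1) * y)            ≡⟨ ℤ.pos-+ (a * x) ((a + 1) * y) ⟩
  + (a * x) +ℤ + ((a + 1) * y)       ≡⟨ cong₂ _+ℤ_ (ℤ.pos-* a x) (ℤ.pos-* (a + 1) y) ⟩
  + a *ℤ + x +ℤ (+ a +ℤ + 1) *ℤ + y  ≡⟨ eq ⟩
  + n                                ∎)
  where open ≡-Reasoning

theorem4p1 : (n : ℕ) (a : ℤ) (k d : ℕ) → 1 ≤ n → 1 ≤ k → 1 ≤ d →
    (x₁ y₁ x₂ y₂ : ℕ) →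
    a *ℤ (+ x₁) +ℤ (a +ℤ + 1) *ℤ (+ y₁) ≡ + n →
    a *ℤ (+ x₂) +ℤ (a +ℤ + 1) *ℤ (+ y₂) ≡ + n →
    ∃[ f ] (Equitable {n} {(x₁ + y₁) + (x₂ + y₂)} f × IsTreeColoring f k d ×
      ((i : Fin ((x₁ + y₁) + (x₂ + y₂))) →
        (+ classSize f i ≡ a) ⊎ (+ classSize f i ≡ a +ℤ + 1)))
theorem4p1 n (+ a) k d _ _ _ x₁ y₁ x₂ y₂ eq₁ eq₂ =
  f , sizesAOrA+1⇒equitable f a sizes , bipartiteColouring-isTreeColouring g₁ g₂ k d ,
  Data.Sum.map (cong (+_)) (cong (+_)) ∘ sizes
  where
  side₁ : a * x₁ + (a + 1) * y₁ ≡ n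
  side₁ = pos-equation⇒ℕ-equation a x₁ y₁ n eq₁
  side₂ : a * x₂ + (a + 1) * y₂ ≡ n
  side₂ = pos-equation⇒ℕ-equation a x₂ y₂ n eq₂
  g₁ : Fin n → Fin (x₁ + y₁)
  g₁ = blockSide a x₁ y₁ side₁
  g₂ : Fin n → Fin (x₂ + y₂)
  g₂ = blockSide a x₂ y₂ side₂
  f : Coloring n ((x₁ + y₁) + (x₂ + y₂))
  f = bipartiteColouring g₁ g₂
  sizes : ∀ i → SizeAOrA+1 a (classSize f i)
  sizes = classSizes-bipartiteColouring g₁ g₂ (SizeAOrA+1 a)
    (occurrences-blockSide a x₁ y₁ side₁) (occurrences-blockSide a x₂ y₂ side₂)
theorem4p1 _ -[1+ m ] k d (s≤s _) _ _ x₁ y₁ x₂ y₂ eq₁ _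
  with ℤ.+≤+ () ← subst (ℤ._≤ 0ℤ) eq₁ (negativeCoefficients≤0 m x₁ y₁)
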